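{- Let $a,b,c>1$ be integers with $\gcd(a,b)>1$, and let $p,q\in Q$ be primes with $\frac{\alpha_p}{\beta_p}>\frac{\alpha_q}{\beta_q}$ and $\frac{\alpha_p}{\gamma_p}>\frac{\alpha_q}{\gamma_q}$. Then the equation $a^x+b^y=c^z$ has no solution in positive integers which is Type B, Type C, or Type O for $p$.
   Context: $Q$ is the set of primes dividing all of $a$, $b$, $c$. For $r\in Q$ let $r^{\alpha_r}\parallel a$, $r^{\beta_r}\parallel b$, $r^{\gamma_r}\parallel c$. A solution $(x,y,z)$ is Type B for $r$ if $\beta_ry>\alpha_rx=\gamma_rz$; Type C if $\gamma_rz>\alpha_rx=\beta_ry$; Type O if $\alpha_rx=\beta_ry=\gamma_rz$. -}

module Defs where

open import Data.Nat using (ℕ; suc; _^_; _*_; _<_)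
open import Data.Nat.Divisibility using (_∣_)
open import Data.Nat.Primality using (Prime)
open import Data.Product using (_×_)
open import Relation.Nullary using (¬_)
open import Relation.Binary.PropositionalEquality using (_≡_)

_^_∥_ : ℕ → ℕ → ℕ → Set
r ^ k ∥ n = (r ^ k) ∣ n × ¬ ((r ^ suc k) ∣ n)

-- r ∈ Q(a,b,c): r is a prime dividing all of a, b, c
InQ : ℕ → ℕ → ℕ → ℕ → Set
InQ r a b c = Prime r × (r ∣ a × (r ∣ b × r ∣ c))

-- Solution types for a prime r with r^α ∥ a, r^β ∥ b, r^γ ∥ c
TypeB : (α β γ x y z : ℕ) → Set
TypeB α β γ x y z = (α * x < β * y) × (α * x ≡ γ * z)

TypeC : (α β γ x y z : ℕ) → Set
TypeC α β γ x y z = (α * x < γ * z) × (α * x ≡ β * y)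

TypeO : (α β γ x y z : ℕ) → Set
TypeO α β γ x y z = (α * x ≡ β * y) × (β * y ≡ γ * z)

-- In a solution of Type B, C or O for p, the term a^x has the least p-adic valuation among a^x, b^y, c^z.
-- The two ratio inequalities turn this into strict minimality for q:
-- v_q(a^x) = αq x < βq y = v_q(b^y) and v_q(a^x) < γq z = v_q(c^z).
-- But then v_q(c^z) = v_q(a^x + b^y) = v_q(a^x), a contradiction.
module Submission where

open import Defs
open import Data.Nat using (ℕ; zero; suc; _^_; _*_; _+_; _<_; _≤_)
open import Data.Nat.Properties
open import Data.Nat.Divisibility
open import Data.Nat.Primality using (Prime; euclidsLemma; ¬prime[1]; prime⇒nonZero)
open import Data.Nat.GCD using (gcd)
open import Algebra.Properties.CommutativeSemigroup *-commutativeSemigroup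
  using (interchange; x∙yz≈y∙xz)
open import Data.Product using (_×_; _,_; proj₁; proj₂)
open import Data.Sum using (_⊎_; inj₁; inj₂; [_,_]′)
open import Relation.Nullary using (¬_)
open import Relation.Binary.PropositionalEquality
  using (_≡_; refl; sym; trans; cong; cong₂; subst; module ≡-Reasoning)

^-monoʳ-∣ : ∀ p {m n} → m ≤ n → p ^ m ∣ p ^ n
^-monoʳ-∣ p {m} m≤n with m≤n⇒∃[o]m+o≡n m≤n
... | o , refl = divides (p ^ o) (trans (^-distribˡ-+-* p m o) (*-comm (p ^ m) (p ^ o)))

∥⇒∤quotient : ∀ {p k n} (p^k∥n : p ^ k ∥ n) → ¬ (p ∣ quotient (proj₁ p^k∥n))
∥⇒∤quotient {p} {k} (divides m n≡m*p^k , p^1+k∤n) p∣m =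
  p^1+k∤n (subst (p * p ^ k ∣_) (sym n≡m*p^k) (*-monoˡ-∣ (p ^ k) p∣m))

∥-* : ∀ {p k l m n} → Prime p → p ^ k ∥ m → p ^ l ∥ n → p ^ (k + l) ∥ (m * n)
∥-* {p} {k} {l} {m} {n} prime-p p^k∥m@(divides u m≡u*p^k , _) p^l∥n@(divides v n≡v*p^l , _) =
  divides (u * v) m*n≡u*v*p^k+l , p^1+k+l∤m*n
  where
  open ≡-Reasoning

  m*n≡u*v*p^k+l : m * n ≡ (u * v) * p ^ (k + l)
  m*n≡u*v*p^k+l = begin
    m * n                     ≡⟨ cong₂ _*_ m≡u*p^k n≡v*p^l ⟩
    (u * p ^ k) * (v * p ^ l) ≡⟨ interchange u (p ^ k) v (p ^ l) ⟩
    (u * v) * (p ^ k * p ^ l) ≡⟨ cong ((u * v) *_) (^-distribˡ-+-* p k l) ⟨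
    (u * v) * p ^ (k + l)     ∎

  p^1+k+l∤m*n : ¬ (p ^ suc (k + l) ∣ m * n)
  p^1+k+l∤m*n p^1+k+l∣m*n =
    [ ∥⇒∤quotient {k = k} p^k∥m , ∥⇒∤quotient {k = l} p^l∥n ]′ (euclidsLemma u v prime-p p∣u*v)
    where
    instance _ = m^n≢0 p (k + l) {{prime⇒nonZero prime-p}}
    p∣u*v : p ∣ u * v
    p∣u*v = *-cancelʳ-∣ (p ^ (k + l))
      (subst (p ^ suc (k + l) ∣_) m*n≡u*v*p^k+l p^1+k+l∣m*n)

∥-^ : ∀ {p k n} → Prime p → p ^ k ∥ n → ∀ x → p ^ (k * x) ∥ (n ^ x)
∥-^ {p} {k} prime-p _ zero rewrite *-zeroʳ k =
  1∣ 1 , λ p^1∣1 → ¬prime[1] (subst Prime (∣1⇒≡1 (∣-trans (m∣m*n 1) p^1∣1)) prime-p)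
∥-^ {k = k} prime-p p^k∥n (suc x) rewrite *-suc k x =
  ∥-* {k = k} {l = k * x} prime-p p^k∥n (∥-^ {k = k} prime-p p^k∥n x)

∥-+ : ∀ {p k m n} → p ^ k ∥ m → p ^ suc k ∣ n → p ^ k ∥ (m + n)
∥-+ {p} {k} {m} {n} (p^k∣m , p^1+k∤m) p^1+k∣n =
  ∣m∣n⇒∣m+n p^k∣m (∣-trans (n∣m*n p) p^1+k∣n) ,
  λ p^1+k∣m+n → p^1+k∤m (∣m+n∣m⇒∣n (subst (p ^ suc k ∣_) (+-comm m n) p^1+k∣m+n) p^1+k∣n)

-- a′/b′ < a/b ≤ y/x, with the denominators cleared.
<-≤-trans-ratio : ∀ {a b a′ b′ x y} → a′ * b < a * b′ → a * x ≤ b * y → 0 < y →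
                  a′ * x < b′ * y
<-≤-trans-ratio {a} {b} {a′} {b′} {x} {y@(suc _)} a′b<ab′ ax≤by _ =
  *-cancelˡ-< a (a′ * x) (b′ * y) (begin-strict
    a * (a′ * x)   ≡⟨ x∙yz≈y∙xz a a′ x ⟩
    a′ * (a * x)   ≤⟨ *-monoʳ-≤ a′ ax≤by ⟩
    a′ * (b * y)   ≡⟨ *-assoc a′ b y ⟨
    (a′ * b) * y   <⟨ *-monoˡ-< y a′b<ab′ ⟩
    (a * b′) * y   ≡⟨ *-assoc a b′ y ⟩
    a * (b′ * y)   ∎)
  where open ≤-Reasoning

TypeBCO⇒αx-minimal : ∀ {α β γ x y z} →
  TypeB α β γ x y z ⊎ TypeC α β γ x y z ⊎ TypeO α β γ x y z →
  α * x ≤ β * y × α * x ≤ γ * z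
TypeBCO⇒αx-minimal (inj₁ (αx<βy , αx≡γz))        = <⇒≤ αx<βy , ≤-reflexive αx≡γz
TypeBCO⇒αx-minimal (inj₂ (inj₁ (αx<γz , αx≡βy))) = ≤-reflexive αx≡βy , <⇒≤ αx<γz
TypeBCO⇒αx-minimal (inj₂ (inj₂ (αx≡βy , βy≡γz))) =
  ≤-reflexive αx≡βy , ≤-reflexive (trans αx≡βy βy≡γz)

lemma2 : (a b c : ℕ) → 1 < a → 1 < b → 1 < c → 1 < gcd a b →
         (p q : ℕ) → InQ p a b c → InQ q a b c →
         (αp βp γp αq βq γq : ℕ) →
         p ^ αp ∥ a → p ^ βp ∥ b → p ^ γp ∥ c →
         q ^ αq ∥ a → q ^ βq ∥ b → q ^ γq ∥ c →
         αq * βp < αp * βq →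
         αq * γp < αp * γq →
         (x y z : ℕ) → 0 < x → 0 < y → 0 < z →
         a ^ x + b ^ y ≡ c ^ z →
         ¬ (TypeB αp βp γp x y z ⊎ TypeC αp βp γp x y z ⊎ TypeO αp βp γp x y z)
lemma2 a b c _ _ _ _ p q _ (prime-q , _) αp βp γp αq βq γq _ _ _
       q^αq∥a q^βq∥b q^γq∥c αqβp<αpβq αqγp<αpγq x y z _ y>0 z>0 a^x+b^y≡c^z type
  with TypeBCO⇒αx-minimal {αp} {βp} {γp} {x} {y} {z} type
... | αpx≤βpy , αpx≤γpz = proj₂ (∥-+ {k = αq * x} q^αqx∥a^x q^1+αqx∣b^y)
                            (subst (q ^ suc (αq * x) ∣_) (sym a^x+b^y≡c^z) q^1+αqx∣c^z)
  where
  q^αqx∥a^x : q ^ (αq * x) ∥ (a ^ x)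
  q^αqx∥a^x = ∥-^ {k = αq} prime-q q^αq∥a x

  q^1+αqx∣b^y : q ^ suc (αq * x) ∣ b ^ y
  q^1+αqx∣b^y = ∣-trans (^-monoʳ-∣ q (<-≤-trans-ratio {αp} {βp} {αq} {βq} αqβp<αpβq αpx≤βpy y>0))
                        (proj₁ (∥-^ {k = βq} prime-q q^βq∥b y))

  q^1+αqx∣c^z : q ^ suc (αq * x) ∣ c ^ z
  q^1+αqx∣c^z = ∣-trans (^-monoʳ-∣ q (<-≤-trans-ratio {αp} {γp} {αq} {γq} αqγp<αpγq αpx≤γpz z>0))
                        (proj₁ (∥-^ {k = γq} prime-q q^γq∥c z))
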